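{- Let $n\geq 1$ and $k\geq 2$ be integers with $F_k\leq n<F_{k+1}$. Then the number of edges of $G_n$ is $$|E(G_n)|=\begin{cases} n+\dfrac{F_k+1}{2}-\dfrac{\left\lfloor\frac{4(k+1)}{3}\right\rfloor}{2} & \text{if } n\leq \tfrac{F_{k+2}}{2},\\[2ex] 2n+\dfrac{F_k+1}{2}-\dfrac{\left\lfloor\frac{4(k+1)}{3}\right\rfloor}{2}-\left\lceil\dfrac{F_{k+2}-1}{2}\right\rceil & \text{if } n>\tfrac{F_{k+2}}{2}.\end{cases}$$
   Context: The Fibonacci numbers are defined by $F_0=0$, $F_1=1$ and $F_m=F_{m-1}+F_{m-2}$ for $m\geq 2$. For each integer $n\geq 1$, the Fibonacci-sum graph $G_n$ is the simple graph with vertex set $\{1,2,\dots,n\}$ in which distinct vertices $i,j$ are adjacent if and only if $i+j$ is a Fibonacci number. -}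

module Defs where

open import Data.Nat using (ℕ; zero; suc; _+_; _*_; _∸_; _≤_; _<_; _≤?_; _<?_; s≤s; z≤n)
open import Data.Nat.Properties
open import Data.List using (List; []; _∷_; concatMap; filter; length; upTo; map)
open import Data.Product using (Σ; ∃; ∃-syntax; _×_; _,_)
open import Relation.Binary.PropositionalEquality using (_≡_; refl; sym; subst)
open import Relation.Nullary using (Dec; yes; no; ¬_)
open import Relation.Nullary.Decidable using (_×-dec_)
open import Data.Empty using (⊥-elim)

fib : ℕ → ℕ
fib zero = zero
fib (suc zero) = suc zero
fib (suc (suc m)) = fib (suc m) + fib m

IsFib : ℕ → Set
IsFib s = ∃[ m ] fib m ≡ s

fib-growth : ∀ m → m ≤ fib (suc m)
fib-growth zero = z≤n
fib-growth (suc zero) = s≤s z≤n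
fib-growth (suc (suc m)) =
  subst (_≤ fib (suc (suc (suc m)))) (+-comm (suc m) 1)
    (+-mono-≤ {suc m} {fib (suc (suc m))} {1} {fib (suc m)}
      (fib-growth (suc m)) (fib-pos m))
  where
  fib-pos : ∀ m → 1 ≤ fib (suc m)
  fib-pos zero = s≤s z≤n
  fib-pos (suc m) = ≤-trans (fib-pos m) (m≤m+n (fib (suc m)) (fib m))

private
  search : (s b : ℕ) → Dec (∃[ m ] (m < b × fib m ≡ s))
  search s zero = no λ { (m , () , _) }
  search s (suc b) with fib b ≟ s
  ... | yes e = yes (b , ≤-refl , e)
  ... | no ne with search s b
  ...   | yes (m , m<b , e) = yes (m , m<n⇒m<1+n m<b , e)
  ...   | no nm = no λ { (m , m<1+b , e) → help m m<1+b e }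
    where
    help : ∀ m → m < suc b → fib m ≡ s → _
    help m m<1+b e with m ≟ b
    ... | yes refl = ne e
    ... | no m≢b = nm (m , ≤∧≢⇒< (≤-pred m<1+b) m≢b , e)

isFib? : (s : ℕ) → Dec (IsFib s)
isFib? s with search s (suc (suc s))
... | yes (m , _ , e) = yes (m , e)
... | no nm = no λ { (m , e) → go m e }
  where
  go : ∀ m → fib m ≡ s → _
  go m e with m <? suc (suc s)
  ... | yes lt = nm (m , lt , e)
  go zero e | no ge = ge (s≤s z≤n)
  go (suc m) e | no ge =
    ge (s≤s (s≤s (subst (m ≤_) e (fib-growth m))))

-- Edges of the Fibonacci-sum graph G_n: pairs (i , j) with 1 ≤ i < j ≤ n
-- (each unordered edge {i,j} listed once) such that i + j is a Fibonacci number.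
pairs : ℕ → List (ℕ × ℕ)
pairs n = concatMap (λ j → map (λ i → (suc i , suc j)) (upTo j)) (upTo n)

IsEdge : ℕ × ℕ → Set
IsEdge (i , j) = IsFib (i + j)

isEdge? : (p : ℕ × ℕ) → Dec (IsEdge p)
isEdge? (i , j) = isFib? (i + j)

edges : ℕ → List (ℕ × ℕ)
edges n = filter isEdge? (pairs n)

numEdges : ℕ → ℕ
numEdges n = length (edges n)

module Submission where

-- Write c_k = ⌊F_{k+2}/2⌋ and q_k = ⌊4(k+1)/3⌋.  Both cases of the theorem
-- are instances of the single invariant
--     2|E(G_n)| + q_k + 2 min(n, c_k) = 4n + F_k + 1,
-- which is proved by induction on n.  Passing from G_m to G_{m+1} adds the
-- vertex m+1, whose neighbours u ≤ m satisfy m+2 ≤ u+(m+1) ≤ 2m+1; in that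
-- range the only Fibonacci numbers are F_{k+1} and F_{k+2}, and each value in
-- the range is hit by exactly one u.  So the new vertex has degree 1 + [2m+1 ≥
-- F_{k+2}] inside the window F_k ≤ m < m+1 < F_{k+1}, and degree 1 when m+1 =
-- F_{k+1} opens the next window.  The first case keeps the invariant by plain
-- arithmetic; the second additionally uses the parity identity
--     F_{k+2} + q_{k+1} = 2 + q_k + 2⌊F_{k+2}/2⌋,
-- which holds because F_m is even exactly when 3 ∣ m.

open import Defs
open import Data.Nat using (ℕ; zero; suc; _+_; _*_; _∸_; _⊓_; _≤_; _<_; s≤s; z≤n; _/_)
open import Data.Nat.Properties
open import Data.Nat.DivMod using (+-distrib-/-∣ʳ; m*n/n≡m; /-monoˡ-≤)
open import Data.Nat.Divisibility using (divides)
open import Data.Nat.Tactic.RingSolver using (solve-∀)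
open import Data.Integer using (ℤ; +_; _-_)
open import Data.Integer.Properties using ([+m]-[+n]≡m⊖n; ⊖-≥)
open import Data.List using (List; []; _∷_; _++_; filter; length; upTo; map; concatMap)
open import Data.List.Properties using (upTo-∷ʳ; filter-++; length-++; concatMap-++; ++-identityʳ)
open import Data.Product using (_×_; _,_; proj₁; proj₂)
open import Data.Sum using (_⊎_; inj₁; inj₂)
open import Data.Empty using (⊥; ⊥-elim)
open import Relation.Nullary using (Dec; yes; no; ¬_)
open import Relation.Unary using (Decidable)
open import Relation.Binary using (tri<; tri≈; tri>)
open import Relation.Binary.PropositionalEquality

indicator : {A : Set} → Dec A → ℕ
indicator (yes _) = 1
indicator (no _) = 0

count : {P : ℕ → Set} → Decidable P → ℕ → ℕ
count P? zero = 0
count P? (suc n) = indicator (P? n) + count P? n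

length-filter-upTo : {P : ℕ → Set} (P? : Decidable P) (n : ℕ) →
  length (filter P? (upTo n)) ≡ count P? n
length-filter-upTo P? zero = refl
length-filter-upTo P? (suc n) = begin
  length (filter P? (upTo (suc n)))                   ≡⟨ cong (λ l → length (filter P? l)) (sym (upTo-∷ʳ n)) ⟩
  length (filter P? (upTo n ++ n ∷ []))               ≡⟨ cong length (filter-++ P? (upTo n) (n ∷ [])) ⟩
  length (filter P? (upTo n) ++ filter P? (n ∷ []))   ≡⟨ length-++ (filter P? (upTo n)) ⟩
  length (filter P? (upTo n)) + length (filter P? (n ∷ [])) ≡⟨ cong₂ _+_ (length-filter-upTo P? n) singleton ⟩
  count P? n + indicator (P? n)                       ≡⟨ +-comm (count P? n) _ ⟩
  count P? (suc n)                                    ∎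
  where
  open ≡-Reasoning
  singleton : length (filter P? (n ∷ [])) ≡ indicator (P? n)
  singleton with P? n
  ... | yes _ = refl
  ... | no _ = refl

length-filter-map : {A B : Set} {P : B → Set} (P? : Decidable P) (h : A → B) (xs : List A) →
  length (filter P? (map h xs)) ≡ length (filter (λ x → P? (h x)) xs)
length-filter-map P? h [] = refl
length-filter-map P? h (x ∷ xs) with P? (h x)
... | yes _ = cong suc (length-filter-map P? h xs)
... | no _ = length-filter-map P? h xs

count-cong : {P Q : ℕ → Set} (P? : Decidable P) (Q? : Decidable Q) (n : ℕ) →
  (∀ i → i < n → P i → Q i) → (∀ i → i < n → Q i → P i) → count P? n ≡ count Q? n
count-cong P? Q? zero _ _ = refl
count-cong P? Q? (suc n) P⇒Q Q⇒P
  with P? n | Q? n | count-cong P? Q? n (λ i i<n → P⇒Q i (m<n⇒m<1+n i<n)) (λ i i<n → Q⇒P i (m<n⇒m<1+n i<n))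
... | yes _ | yes _ | ih = cong suc ih
... | no _  | no _  | ih = ih
... | yes p | no ¬q | _  = ⊥-elim (¬q (P⇒Q n ≤-refl p))
... | no ¬p | yes q | _  = ⊥-elim (¬p (Q⇒P n ≤-refl q))

count-none : {P : ℕ → Set} (P? : Decidable P) (n : ℕ) → (∀ i → i < n → ¬ P i) → count P? n ≡ 0
count-none P? zero _ = refl
count-none P? (suc n) none with P? n
... | yes p = ⊥-elim (none n ≤-refl p)
... | no _ = count-none P? n (λ i i<n → none i (m<n⇒m<1+n i<n))

count-single : (a n : ℕ) → a < n → count (_≟ a) n ≡ 1
count-single a (suc n) a<1+n with n ≟ a
... | yes refl = cong suc (count-none (_≟ n) n (λ i i<n i≡n → <-irrefl i≡n i<n))
... | no n≢a = count-single a n (≤∧≢⇒< (≤-pred a<1+n) (λ a≡n → n≢a (sym a≡n)))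

count-⊎ : {P Q R : ℕ → Set} (P? : Decidable P) (Q? : Decidable Q) (R? : Decidable R) (n : ℕ) →
  (∀ i → i < n → P i → Q i ⊎ R i) → (∀ i → Q i → P i) → (∀ i → R i → P i) →
  (∀ i → Q i → R i → ⊥) → count P? n ≡ count Q? n + count R? n
count-⊎ P? Q? R? zero _ _ _ _ = refl
count-⊎ P? Q? R? (suc n) split Q⇒P R⇒P disj
  with P? n | Q? n | R? n | count-⊎ P? Q? R? n (λ i i<n → split i (m<n⇒m<1+n i<n)) Q⇒P R⇒P disj
... | _     | yes q | yes r | _  = ⊥-elim (disj n q r)
... | yes _ | yes _ | no _  | ih = cong suc ih
... | yes _ | no _  | yes _ | ih = trans (cong suc ih) (sym (+-suc (count Q? n) (count R? n)))
... | no _  | no _  | no _  | ih = ih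
... | no ¬p | yes q | no _  | _  = ⊥-elim (¬p (Q⇒P n q))
... | no ¬p | no _  | yes r | _  = ⊥-elim (¬p (R⇒P n r))
... | yes p | no ¬q | no ¬r | _ with split n ≤-refl p
...   | inj₁ q = ⊥-elim (¬q q)
...   | inj₂ r = ⊥-elim (¬r r)

row : ℕ → List (ℕ × ℕ)
row m = map (λ i → (suc i , suc m)) (upTo m)

pairs-suc : (m : ℕ) → pairs (suc m) ≡ pairs m ++ row m
pairs-suc m = begin
  concatMap row (upTo (suc m))         ≡⟨ cong (concatMap row) (sym (upTo-∷ʳ m)) ⟩
  concatMap row (upTo m ++ m ∷ [])     ≡⟨ concatMap-++ row (upTo m) (m ∷ []) ⟩
  pairs m ++ (row m ++ [])             ≡⟨ cong (pairs m ++_) (++-identityʳ (row m)) ⟩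
  pairs m ++ row m                     ∎
  where open ≡-Reasoning

degree : ℕ → ℕ
degree m = count (λ i → isFib? (suc i + suc m)) m

numEdges-suc : (m : ℕ) → numEdges (suc m) ≡ numEdges m + degree m
numEdges-suc m = begin
  length (filter isEdge? (pairs (suc m)))                      ≡⟨ cong (λ l → length (filter isEdge? l)) (pairs-suc m) ⟩
  length (filter isEdge? (pairs m ++ row m))                   ≡⟨ cong length (filter-++ isEdge? (pairs m) (row m)) ⟩
  length (filter isEdge? (pairs m) ++ filter isEdge? (row m))  ≡⟨ length-++ (filter isEdge? (pairs m)) ⟩
  numEdges m + length (filter isEdge? (row m))                 ≡⟨ cong (λ d → numEdges m + d) row-edges ⟩
  numEdges m + degree m                                        ∎
  where
  open ≡-Reasoning
  row-edges : length (filter isEdge? (row m)) ≡ degree m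
  row-edges = trans (length-filter-map isEdge? (λ i → (suc i , suc m)) (upTo m)) (length-filter-upTo _ m)

hits : ℕ → ℕ → ℕ
hits m s = count (λ i → suc i + suc m ≟ s) m

partner-sum-range : (m i : ℕ) → i < m → suc (suc m) ≤ suc i + suc m × suc i + suc m ≤ suc (2 * m)
partner-sum-range m i i<m = s≤s (m≤n+m (suc m) i) , subst (suc i + suc m ≤_) (lemma m) (+-monoˡ-≤ (suc m) i<m)
  where
  lemma : ∀ m → m + suc m ≡ suc (2 * m)
  lemma = solve-∀

hits-inside : (m s : ℕ) → suc (suc m) ≤ s → s ≤ suc (2 * m) → hits m s ≡ 1
hits-inside m s lo hi with m≤n⇒∃[o]m+o≡n lo
... | a , refl = trans (count-cong _ (_≟ a) m (λ i _ → cancel i) (λ i _ → uncancel i)) (count-single a m a<m)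
  where
  shift : ∀ i m → suc i + suc m ≡ suc (suc m) + i
  shift = solve-∀
  cancel : ∀ i → suc i + suc m ≡ suc (suc m) + a → i ≡ a
  cancel i e = +-cancelˡ-≡ (suc (suc m)) i a (trans (sym (shift i m)) e)
  uncancel : ∀ i → i ≡ a → suc i + suc m ≡ suc (suc m) + a
  uncancel i refl = shift i m
  a<m : a < m
  a<m = +-cancelˡ-< (suc m) a m (subst (suc (suc m) + a ≤_) (double m) hi)
    where
    double : ∀ m → suc (2 * m) ≡ suc m + m
    double = solve-∀

hits-below : (m s : ℕ) → s ≤ suc m → hits m s ≡ 0
hits-below m s s≤ = count-none _ m λ i i<m e →
  <⇒≱ (proj₁ (partner-sum-range m i i<m)) (subst (_≤ suc m) (sym e) s≤)

hits-above : (m s : ℕ) → suc (2 * m) < s → hits m s ≡ 0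
hits-above m s <s = count-none _ m λ i i<m e →
  <⇒≱ <s (subst (_≤ suc (2 * m)) e (proj₂ (partner-sum-range m i i<m)))

fib-pos : (m : ℕ) → 0 < fib (suc m)
fib-pos zero = s≤s z≤n
fib-pos (suc m) = ≤-trans (fib-pos m) (m≤m+n (fib (suc m)) (fib m))

fib-mono : {m m′ : ℕ} → m ≤ m′ → fib m ≤ fib m′
fib-mono {m} {m′} m≤m′ with m≤n⇒∃[o]m+o≡n m≤m′
... | d , refl = go d
  where
  step : ∀ j → fib j ≤ fib (suc j)
  step zero = z≤n
  step (suc j) = m≤m+n (fib (suc j)) (fib j)
  go : ∀ d → fib m ≤ fib (m + d)
  go zero = ≤-reflexive (cong fib (sym (+-identityʳ m)))
  go (suc d) = ≤-trans (go d) (subst (λ x → fib (m + d) ≤ fib x) (sym (+-suc m d)) (step (m + d)))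

fib-<-suc : (k : ℕ) → 0 < fib k → fib (suc k) < fib (suc (suc k))
fib-<-suc k pos = m<m+n (fib (suc k)) pos

fib-suc-≤ : (k : ℕ) → fib (suc k) ≤ suc (2 * fib k)
fib-suc-≤ zero = ≤-refl
fib-suc-≤ (suc k) = ≤-trans (+-monoʳ-≤ (fib (suc k)) (fib-mono (n≤1+n k)))
                            (≤-trans (≤-reflexive (twice (fib (suc k)))) (n≤1+n _))
  where
  twice : ∀ x → x + x ≡ 2 * x
  twice = solve-∀

-- Window lemma: if F_k ≤ m < F_{k+1}, the only Fibonacci numbers in (m, 2m+1]
-- are F_{k+1} and F_{k+2}, since F_{k+3} = F_{k+2} + F_{k+1} ≥ 2(m+1).
fib-window : (k m s : ℕ) → fib k ≤ m → m < fib (suc k) → IsFib s → m < s → s ≤ suc (2 * m) →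
  s ≡ fib (suc k) ⊎ s ≡ fib (suc (suc k))
fib-window k m s lo hi (j , refl) m<s s≤ with j ≤? k
... | yes j≤k = ⊥-elim (<⇒≱ m<s (≤-trans (fib-mono j≤k) lo))
... | no j≰k with <-cmp j (suc (suc k))
...   | tri< j<k+2 _ _ = inj₁ (cong fib (≤-antisym (≤-pred j<k+2) (≰⇒> j≰k)))
...   | tri≈ _ refl _ = inj₂ refl
...   | tri> _ _ k+2<j = ⊥-elim (<⇒≱ (s≤s s≤) (begin
  suc (suc (2 * m))                             ≡⟨ double m ⟩
  suc m + suc m                                 ≤⟨ +-mono-≤ (≤-trans hi (fib-mono (n≤1+n (suc k)))) hi ⟩
  fib (suc (suc k)) + fib (suc k)               ≤⟨ fib-mono k+2<j ⟩
  fib j                                         ∎))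
  where
  open ≤-Reasoning
  double : ∀ m → suc (suc (2 * m)) ≡ suc m + suc m
  double = solve-∀

degree-window : (k m : ℕ) → 0 < fib k → fib k ≤ m → m < fib (suc k) →
  degree m ≡ hits m (fib (suc k)) + hits m (fib (suc (suc k)))
degree-window k m pos lo hi =
  count-⊎ _ _ _ m split (λ i e → suc k , sym e) (λ i e → suc (suc k) , sym e)
    (λ i e₁ e₂ → <-irrefl (trans (sym e₁) e₂) (fib-<-suc k pos))
  where
  split : ∀ i → i < m → IsFib (suc i + suc m) →
    suc i + suc m ≡ fib (suc k) ⊎ suc i + suc m ≡ fib (suc (suc k))
  split i i<m isFib with partner-sum-range m i i<m
  ... | lower , upper = fib-window k m _ lo hi isFib (≤-trans (n≤1+n (suc m)) lower) upper

half-+ : (f x : ℕ) → (f + x * 2) / 2 ≡ f / 2 + x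
half-+ f x = trans (+-distrib-/-∣ʳ f {d = 2} (divides x refl)) (cong (λ h → f / 2 + h) (m*n/n≡m x 2))

≤-half : (m s : ℕ) → 2 * m ≤ s → m ≤ s / 2
≤-half m s 2m≤s = subst (_≤ s / 2) (trans (cong (_/ 2) (*-comm 2 m)) (half-+ 0 m)) (/-monoˡ-≤ 2 2m≤s)

half-≤ : (m s : ℕ) → s ≤ suc (2 * m) → s / 2 ≤ m
half-≤ m s s≤ = subst (s / 2 ≤_) (trans (cong (λ x → suc x / 2) (*-comm 2 m)) (half-+ 1 m)) (/-monoˡ-≤ 2 s≤)

q : ℕ → ℕ
q k = 4 * suc k / 3

q-+3 : (k : ℕ) → q (3 + k) ≡ q k + 4
q-+3 k = trans (cong (_/ 3) (shift k)) (+-distrib-/-∣ʳ (4 * suc k) {d = 3} (divides 4 refl))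
  where
  shift : ∀ k → 4 * suc (3 + k) ≡ 4 * suc k + 4 * 3
  shift = solve-∀

-- F_{m+3} = F_m + 2F_{m+1}: the Fibonacci numbers mod 2 have period 3.
fib-+3 : (m : ℕ) → fib (3 + m) ≡ fib m + fib (suc m) * 2
fib-+3 m = regroup (fib (suc m)) (fib m)
  where
  regroup : ∀ a b → a + b + a ≡ b + a * 2
  regroup = solve-∀

-- Parity identity F_{k+2} + q_{k+1} = 2 + q_k + 2⌊F_{k+2}/2⌋: the Fibonacci
-- number is odd exactly when q jumps by 1 rather than 2.  Both sides shift
-- by the same amount under k ↦ k+3, so the three base cases suffice.
fib-parity : (k : ℕ) → fib (suc (suc k)) + q (suc k) ≡ 2 + q k + 2 * (fib (suc (suc k)) / 2)
fib-parity zero = refl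
fib-parity (suc zero) = refl
fib-parity (suc (suc zero)) = refl
fib-parity (suc (suc (suc k))) = begin
  fib (3 + suc (suc k)) + q (3 + suc k)     ≡⟨ cong₂ _+_ (fib-+3 (suc (suc k))) (q-+3 (suc k)) ⟩
  F + X * 2 + (q (suc k) + 4)               ≡⟨ regroup F X (q (suc k)) ⟩
  (F + q (suc k)) + (X * 2 + 4)             ≡⟨ cong (_+ (X * 2 + 4)) (fib-parity k) ⟩
  2 + q k + 2 * (F / 2) + (X * 2 + 4)       ≡⟨ regroup′ X (q k) (F / 2) ⟩
  2 + (q k + 4) + 2 * (F / 2 + X)           ≡⟨ cong₂ (λ a h → 2 + a + 2 * h) (sym (q-+3 k)) (sym (half-+ F X)) ⟩
  2 + q (3 + k) + 2 * ((F + X * 2) / 2)     ≡⟨ cong (λ y → 2 + q (3 + k) + 2 * (y / 2)) (sym (fib-+3 (suc (suc k)))) ⟩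
  2 + q (3 + k) + 2 * (fib (3 + suc (suc k)) / 2) ∎
  where
  open ≡-Reasoning
  F = fib (suc (suc k))
  X = fib (suc (suc (suc k)))
  regroup : ∀ F X q → F + X * 2 + (q + 4) ≡ (F + q) + (X * 2 + 4)
  regroup = solve-∀
  regroup′ : ∀ X q h → 2 + q + 2 * h + (X * 2 + 4) ≡ 2 + (q + 4) + 2 * (h + X)
  regroup′ = solve-∀

EdgeInvariant : ℕ → ℕ → Set
EdgeInvariant k n = 2 * numEdges n + q k + 2 * (n ⊓ (fib (suc (suc k)) / 2)) ≡ 4 * n + (fib k + 1)

-- Inside a window the new vertex and the growth of min(m, c) together
-- contribute 2: either deg = 1 and the minimum still grows (2m+1 < F_{k+2}),
-- or deg = 2 and the minimum is already c = ⌊F_{k+2}/2⌋.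
degree-balance : (k m : ℕ) → 0 < fib k → fib k ≤ m → suc m < fib (suc k) →
  degree m + suc m ⊓ (fib (suc (suc k)) / 2) ≡ 2 + m ⊓ (fib (suc (suc k)) / 2)
degree-balance k m pos lo hi = by-cases (F ≤? suc (2 * m))
  where
  open ≡-Reasoning
  F = fib (suc (suc k))
  c = F / 2
  -- the sum F_{k+1} always lies in [m+2, 2m+1]
  deg : degree m ≡ 1 + hits m F
  deg = trans (degree-window k m pos lo (<-trans (n<1+n m) hi))
              (cong (_+ hits m F) (hits-inside m (fib (suc k)) hi (≤-trans (fib-suc-≤ k) (s≤s (*-monoʳ-≤ 2 lo)))))
  by-cases : Dec (F ≤ suc (2 * m)) → degree m + suc m ⊓ c ≡ 2 + m ⊓ c
  by-cases (yes F≤) = begin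
    degree m + suc m ⊓ c ≡⟨ cong₂ _+_ (trans deg (cong (_+_ 1) (hits-inside m F m+2≤F F≤))) (m≥n⇒m⊓n≡n (≤-trans c≤m (n≤1+n m))) ⟩
    2 + c                 ≡⟨ cong (_+_ 2) (sym (m≥n⇒m⊓n≡n c≤m)) ⟩
    2 + m ⊓ c             ∎
    where
    c≤m : c ≤ m
    c≤m = half-≤ m F F≤
    m+2≤F : suc (suc m) ≤ F
    m+2≤F = ≤-trans hi (fib-mono (n≤1+n (suc k)))
  by-cases (no F≰) = begin
    degree m + suc m ⊓ c ≡⟨ cong₂ _+_ (trans deg (cong (_+_ 1) (hits-above m F (≰⇒> F≰)))) (m≤n⇒m⊓n≡m m<c) ⟩
    suc (suc m)           ≡⟨ cong (_+_ 2) (sym (m≤n⇒m⊓n≡m (<⇒≤ m<c))) ⟩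
    2 + m ⊓ c             ∎
    where
    m<c : suc m ≤ c
    m<c = ≤-half (suc m) F (subst (_≤ F) (sym (*-distribˡ-+ 2 1 m)) (≰⇒> F≰))

interior-step : (k m : ℕ) → 0 < fib k → fib k ≤ m → suc m < fib (suc k) →
  EdgeInvariant k m → EdgeInvariant k (suc m)
interior-step k m pos lo hi ih = begin
  2 * numEdges (suc m) + q k + 2 * (suc m ⊓ c)      ≡⟨ cong (λ e → 2 * e + q k + 2 * (suc m ⊓ c)) (numEdges-suc m) ⟩
  2 * (E + degree m) + q k + 2 * (suc m ⊓ c)        ≡⟨ regroup E (degree m) (q k) (suc m ⊓ c) ⟩
  2 * E + q k + 2 * (degree m + suc m ⊓ c)          ≡⟨ cong (λ t → 2 * E + q k + 2 * t) (degree-balance k m pos lo hi) ⟩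
  2 * E + q k + 2 * (2 + m ⊓ c)                     ≡⟨ regroup′ E (q k) (m ⊓ c) ⟩
  2 * E + q k + 2 * (m ⊓ c) + 4                     ≡⟨ cong (_+ 4) ih ⟩
  4 * m + (fib k + 1) + 4                           ≡⟨ regroup″ m (fib k + 1) ⟩
  4 * suc m + (fib k + 1)                           ∎
  where
  open ≡-Reasoning
  E = numEdges m
  c = fib (suc (suc k)) / 2
  regroup : ∀ E d q t → 2 * (E + d) + q + 2 * t ≡ 2 * E + q + 2 * (d + t)
  regroup = solve-∀
  regroup′ : ∀ E q t → 2 * E + q + 2 * (2 + t) ≡ 2 * E + q + 2 * t + 4
  regroup′ = solve-∀
  regroup″ : ∀ m f → 4 * m + f + 4 ≡ 4 * suc m + f
  regroup″ = solve-∀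

-- Adding the vertex m+1 = F_{k+1} moves to window k+1.  Its only neighbour is
-- F_{k+2} - (m+1) = F_k, and the parity identity converts q_k + 2⌊F_{k+2}/2⌋
-- into F_{k+2} + q_{k+1} - 2.
boundary-step : (k m : ℕ) → 0 < fib k → fib k ≤ m → suc m ≡ fib (suc k) →
  EdgeInvariant k m → EdgeInvariant (suc k) (suc m)
boundary-step k m pos lo m+1≡F₁ ih = +-cancelʳ-≡ F₂ _ _ (begin
  2 * numEdges (suc m) + q (suc k) + 2 * (suc m ⊓ c′) + F₂
    ≡⟨ cong₂ (λ e t → 2 * e + q (suc k) + 2 * t + F₂) edges≡ (m≤n⇒m⊓n≡m m+1≤c′) ⟩
  2 * (E + 1) + q (suc k) + 2 * suc m + F₂     ≡⟨ regroup E (q (suc k)) m F₂ ⟩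
  2 * E + 2 * m + 4 + (F₂ + q (suc k))         ≡⟨ cong (λ x → 2 * E + 2 * m + 4 + x) (fib-parity k) ⟩
  2 * E + 2 * m + 4 + (2 + q k + 2 * c)        ≡⟨ regroup′ E (q k) c m ⟩
  2 * E + q k + 2 * c + (2 * m + 6)            ≡⟨ cong (λ x → 2 * E + q k + 2 * x + (2 * m + 6)) (sym (m≥n⇒m⊓n≡n c≤m)) ⟩
  2 * E + q k + 2 * (m ⊓ c) + (2 * m + 6)      ≡⟨ cong (_+ (2 * m + 6)) ih ⟩
  4 * m + (fib k + 1) + (2 * m + 6)            ≡⟨ regroup″ m (fib k) ⟩
  4 * suc m + (suc m + 1) + (suc m + fib k)    ≡⟨ cong (λ x → 4 * suc m + (x + 1) + (x + fib k)) m+1≡F₁ ⟩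
  4 * suc m + (fib (suc k) + 1) + F₂           ∎)
  where
  open ≡-Reasoning
  E = numEdges m
  F₂ = fib (suc (suc k))
  c = F₂ / 2
  c′ = fib (suc (suc (suc k))) / 2
  F₂≡ : F₂ ≡ suc m + fib k
  F₂≡ = cong (_+ fib k) (sym m+1≡F₁)
  F₂≤ : F₂ ≤ suc (2 * m)
  F₂≤ = subst₂ _≤_ (sym F₂≡) (cong (λ x → suc (m + x)) (sym (+-identityʳ m))) (s≤s (+-monoʳ-≤ m lo))
  c≤m : c ≤ m
  c≤m = half-≤ m F₂ F₂≤
  m+1≤c′ : suc m ≤ c′
  m+1≤c′ = ≤-half (suc m) _ (subst (_≤ F₂ + fib (suc k)) (cong (λ x → x + (x + 0)) (sym m+1≡F₁))
                               (+-mono-≤ (fib-mono (n≤1+n (suc k))) (≤-reflexive (+-identityʳ (fib (suc k))))))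
  m+2≤F₂ : suc (suc m) ≤ F₂
  m+2≤F₂ = subst (suc (suc m) ≤_) (sym F₂≡) (m<m+n (suc m) pos)
  edges≡ : numEdges (suc m) ≡ E + 1
  edges≡ = begin
    numEdges (suc m)                      ≡⟨ numEdges-suc m ⟩
    E + degree m                          ≡⟨ cong (λ d → E + d) (degree-window k m pos lo (subst (m <_) m+1≡F₁ (n<1+n m))) ⟩
    E + (hits m (fib (suc k)) + hits m F₂) ≡⟨ cong₂ (λ a b → E + (a + b)) (hits-below m _ (≤-reflexive (sym m+1≡F₁))) (hits-inside m F₂ m+2≤F₂ F₂≤) ⟩
    E + 1                                 ∎
  regroup : ∀ E q m F → 2 * (E + 1) + q + 2 * suc m + F ≡ 2 * E + 2 * m + 4 + (F + q)
  regroup = solve-∀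
  regroup′ : ∀ E q c m → 2 * E + 2 * m + 4 + (2 + q + 2 * c) ≡ 2 * E + q + 2 * c + (2 * m + 6)
  regroup′ = solve-∀
  regroup″ : ∀ m f → 4 * m + (f + 1) + (2 * m + 6) ≡ 4 * suc m + (suc m + 1) + (suc m + f)
  regroup″ = solve-∀

-- The invariant holds throughout every window k ≥ 2, by induction on n: the
-- first vertex n = F_k of a window is reached by a boundary step from window
-- k-1 (or is the base case n = F_2 = 1), every later one by an interior step.
edge-invariant : (k n : ℕ) → 2 ≤ k → fib k ≤ n → n < fib (suc k) → EdgeInvariant k n
edge-invariant zero _ () _ _
edge-invariant (suc zero) _ (s≤s ()) _ _
edge-invariant (suc (suc j)) zero _ lo _ = ⊥-elim (<⇒≱ (fib-pos (suc j)) lo)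
edge-invariant (suc (suc j)) (suc m) 2≤k lo hi with fib (suc (suc j)) ≤? m
... | yes lo′ = interior-step (suc (suc j)) m (fib-pos (suc j)) lo′ hi
                  (edge-invariant (suc (suc j)) m 2≤k lo′ (<-trans (n<1+n m) hi))
... | no F≰m = window-start j (≤-antisym lo (≰⇒> F≰m))
  where
  window-start : ∀ j → fib (suc (suc j)) ≡ suc m → EdgeInvariant (suc (suc j)) (suc m)
  window-start zero refl = refl
  window-start (suc j) F≡m+1 = boundary-step k′ m (fib-pos (suc j)) lo′ (sym F≡m+1)
                                 (edge-invariant k′ m (s≤s (s≤s z≤n)) lo′ (subst (m <_) (sym F≡m+1) (n<1+n m)))
    where
    k′ = suc (suc j)
    lo′ : fib k′ ≤ m
    lo′ = ≤-pred (subst (fib k′ <_) F≡m+1 (fib-<-suc (suc j) (fib-pos j)))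

edges-small-n : (k n : ℕ) → EdgeInvariant k n → 2 * n ≤ fib (suc (suc k)) →
  2 * numEdges n + q k ≡ 2 * n + (fib k + 1)
edges-small-n k n inv 2n≤F = +-cancelʳ-≡ (2 * n) _ _ (begin
  2 * numEdges n + q k + 2 * n            ≡⟨ cong (λ t → 2 * numEdges n + q k + 2 * t) (sym (m≤n⇒m⊓n≡m (≤-half n F 2n≤F))) ⟩
  2 * numEdges n + q k + 2 * (n ⊓ (F / 2)) ≡⟨ inv ⟩
  4 * n + (fib k + 1)                     ≡⟨ regroup n (fib k + 1) ⟩
  2 * n + (fib k + 1) + 2 * n             ∎)
  where
  open ≡-Reasoning
  F = fib (suc (suc k))
  regroup : ∀ n f → 4 * n + f ≡ 2 * n + f + 2 * n
  regroup = solve-∀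

edges-large-n : (k n : ℕ) → EdgeInvariant k n → fib (suc (suc k)) < 2 * n →
  2 * numEdges n + 2 * (fib (suc (suc k)) / 2) + q k ≡ 4 * n + (fib k + 1)
edges-large-n k n inv F<2n = begin
  2 * numEdges n + 2 * (F / 2) + q k       ≡⟨ swap (2 * numEdges n) (2 * (F / 2)) (q k) ⟩
  2 * numEdges n + q k + 2 * (F / 2)       ≡⟨ cong (λ t → 2 * numEdges n + q k + 2 * t) (sym (m≥n⇒m⊓n≡n c≤n)) ⟩
  2 * numEdges n + q k + 2 * (n ⊓ (F / 2)) ≡⟨ inv ⟩
  4 * n + (fib k + 1)                      ∎
  where
  open ≡-Reasoning
  F = fib (suc (suc k))
  c≤n : F / 2 ≤ n
  c≤n = half-≤ n F (≤-trans (<⇒≤ F<2n) (n≤1+n _))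
  swap : ∀ a b c → a + b + c ≡ a + c + b
  swap = solve-∀

solve-for : (a d : ℕ) (x : ℤ) → + (a + d) ≡ x → + a ≡ x - + d
solve-for a d x refl = sym (trans ([+m]-[+n]≡m⊖n (a + d) d) (trans (⊖-≥ (m≤n+m d a)) (cong +_ (m+n∸n≡m a d))))

-- The theorem: the invariant read in the two regimes, moved to ℤ.  After
-- normalising k + 1, k + 2 and ⌈(F_{k+2} - 1)/2⌉ = ⌊F_{k+2}/2⌋ the two cases
-- are edges-small-n and edges-large-n.
corollary3 : (n k : ℕ) → 1 ≤ n → 2 ≤ k → fib k ≤ n → n < fib (k Data.Nat.+ 1) →
    ((2 Data.Nat.* n ≤ fib (k Data.Nat.+ 2) →
        + (2 Data.Nat.* numEdges n)
          ≡ + (2 Data.Nat.* n) Data.Integer.+ + (fib k Data.Nat.+ 1)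
            - + ((4 Data.Nat.* (k Data.Nat.+ 1)) / 3))
    × (fib (k Data.Nat.+ 2) < 2 Data.Nat.* n →
        + (2 Data.Nat.* numEdges n)
          ≡ + (4 Data.Nat.* n) Data.Integer.+ + (fib k Data.Nat.+ 1)
            - + ((4 Data.Nat.* (k Data.Nat.+ 1)) / 3)
            - + (2 Data.Nat.* (((fib (k Data.Nat.+ 2) ∸ 1) Data.Nat.+ 1) / 2))))
corollary3 n k _ 2≤k lo hi rewrite +-comm k 1 | +-comm k 2 | m∸n+n≡m (fib-pos (suc k)) =
  (λ 2n≤F → solve-for (2 * E) (q k) _ (cong +_ (edges-small-n k n inv 2n≤F))) ,
  (λ F<2n → solve-for (2 * E) (2 * (F / 2)) _
              (solve-for (2 * E + 2 * (F / 2)) (q k) _ (cong +_ (edges-large-n k n inv F<2n))))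
  where
  E = numEdges n
  F = fib (suc (suc k))
  inv : EdgeInvariant k n
  inv = edge-invariant k n 2≤k lo hi
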